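{- Let $\mathcal T$ be an irreducible toric trinity. Suppose that a sequence of clockwise moves starts and ends with the same state. Then each black triangle of $\mathcal T$ is changed the same number of times in the sequence.
   Context: A trinity is a triangulation $\mathcal T$ of a compact connected oriented closed surface $\Sigma$ whose vertices are colored red, green, blue so that the endpoints of every edge have different colors. A toric trinity is a trinity on the torus. A triangle is black if its vertices, read clockwise, appear in the cyclic order blue, green, red; otherwise white. A state of a toric trinity is a bijection between white triangles and vertices matching each white triangle with one of its own vertices. Clock moves: for a black triangle $\Delta$ with vertices $u_1,u_2,u_3$ in clockwise order and $W_i$ the white triangle sharing the edge $u_iu_{i+1}$ with $\Delta$ (indices mod 3), $\Delta$ is a clockwise empty black triangle of $s$ if $s$ matches $W_i$ with $u_{i+1}$ for all $i$. The clockwise move changing such a $\Delta$ replaces the pairs $(W_i,u_{i+1})$ by $(W_i,u_i)$ and leaves all other pairs unchanged. (In an irreducible trinity every clock move changes a single black triangle in this way.) Irreducibility: let $\mathcal F$ be the trinity on $S^2$ with three vertices and two triangles. For a trinity $\mathcal T$, a black triangle $\Delta$ of it and a trinity $\mathcal T_0$ on $S^2$ with a chosen (outer) white triangle, the connected sum $\mathcal T\#\mathcal T_0$ is obtained by removing the interior of $\Delta$ and gluing in $\mathcal T_0$ minus the interior of its outer triangle, matching colors on the boundary. It is trivial if $\mathcal T$ or $\mathcal T_0$ is $\mathcal F$. A trinity is irreducible if it is not $\mathcal F$ and is not a nontrivial connected sum. -}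

module Defs where

open import Data.Nat using (ℕ; zero; suc; _+_; _*_)
open import Data.Fin using (Fin; zero; suc; _≟_)
open import Data.Product using (Σ; ∃; ∃₂; _×_; _,_; proj₁; proj₂; uncurry)
open import Data.Sum using (_⊎_)
open import Data.Bool using (Bool; true; false)
open import Data.List using (List; []; _∷_)
open import Relation.Binary.PropositionalEquality using (_≡_; _≢_; refl)
open import Relation.Nullary using (¬_; yes; no)
open import Function.Definitions using (Bijective; Injective)

data Colour : Set where
  red green blue : Colour

next3 : Fin 3 → Fin 3
next3 zero = suc zero
next3 (suc zero) = suc (suc zero)
next3 (suc (suc zero)) = zero

prev3 : Fin 3 → Fin 3
prev3 zero = suc (suc zero)
prev3 (suc zero) = zero
prev3 (suc (suc zero)) = suc zero

_⊕_ : Fin 3 → Fin 3 → Fin 3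
i ⊕ zero = i
i ⊕ suc zero = next3 i
i ⊕ suc (suc zero) = prev3 i

iter : {A : Set} → ℕ → (A → A) → A → A
iter zero h a = a
iter (suc k) h a = iter k h (h a)

-- Triangle f has corners
-- 0,1,2 in CLOCKWISE order, corner f i ∈ Fin v.  Side i of f is the
-- edge from corner i to corner (i+1).  glue f i = (g , j) says that side
-- i of f is glued to side j of g; gluing is orientation reversing
-- (corner g j = corner f (i+1), corner g (j+1) = corner f i), so the
-- resulting closed surface is oriented.

-- the corner of the next triangle obtained by turning around a vertex
turnOf : {t : ℕ} → (Fin t → Fin 3 → Fin t × Fin 3) → Fin t × Fin 3 → Fin t × Fin 3
turnOf glue (f , i) = glue f (prev3 i)

data Reach {t : ℕ} (glue : Fin t → Fin 3 → Fin t × Fin 3) : Fin t → Fin t → Set where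
  here : ∀ {f} → Reach glue f f
  step : ∀ {f g} (i : Fin 3) → Reach glue (proj₁ (glue f i)) g → Reach glue f g

record Trinity (t v : ℕ) : Set where
  field
    corner : Fin t → Fin 3 → Fin v
    glue   : Fin t → Fin 3 → Fin t × Fin 3
    colour : Fin v → Colour
    glue-invol   : ∀ f i → uncurry glue (glue f i) ≡ (f , i)
    glue-irrefl  : ∀ f i → glue f i ≢ (f , i)
    glue-corners : ∀ f i →
      (corner (proj₁ (glue f i)) (proj₂ (glue f i)) ≡ corner f (next3 i)) ×
      (corner (proj₁ (glue f i)) (next3 (proj₂ (glue f i))) ≡ corner f i)
    -- the vertices are exactly the classes of corners under the gluing:
    -- every vertex is a corner, and corners at the same vertex are
    -- connected by turning around that vertex
    corner-surj  : ∀ (x : Fin v) → ∃₂ λ f i → corner f i ≡ x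
    vertex-link  : ∀ f i g j → corner f i ≡ corner g j →
                   ∃ λ k → iter k (turnOf glue) (f , i) ≡ (g , j)
    nonempty     : Fin t
    connected    : ∀ f g → Reach glue f g
    proper       : ∀ f i → colour (corner f i) ≢ colour (corner f (next3 i))

open Trinity public

-- Euler characteristic: V - E + F = v - 3t/2 + t.
-- torus: χ = 0, i.e. 2v = t ; sphere: χ = 2, i.e. 2v = t + 4.
Toric : ∀ {t v} → Trinity t v → Set
Toric {t} {v} _ = 2 * v ≡ t

Spherical : ∀ {t v} → Trinity t v → Set
Spherical {t} {v} _ = 2 * v ≡ t + 4

blackCols : Colour → Colour → Colour → Bool
blackCols blue green red = true
blackCols green red blue = true
blackCols red blue green = true
blackCols _ _ _ = false

isBlack : ∀ {t v} → Trinity t v → Fin t → Bool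
isBlack T f = blackCols (colour T (corner T f zero))
                        (colour T (corner T f (suc zero)))
                        (colour T (corner T f (suc (suc zero))))

Black : ∀ {t v} → Trinity t v → Fin t → Set
Black T f = isBlack T f ≡ true

White : ∀ {t v} → Trinity t v → Fin t → Set
White T f = isBlack T f ≡ false

WhiteTri : ∀ {t v} → Trinity t v → Set
WhiteTri {t} T = Σ (Fin t) (White T)

record State {t v : ℕ} (T : Trinity t v) : Set where
  field
    match : WhiteTri T → Fin v
    own   : ∀ w → ∃ λ i → corner T (proj₁ w) i ≡ match w
    bij   : Bijective _≡_ _≡_ match

open State public

SameState : ∀ {t v} {T : Trinity t v} → State T → State T → Set
SameState {T = T} s s' = ∀ (w : WhiteTri T) → match s w ≡ match s' w

-- ClockwiseMove T s s' f : the black triangle f (corners u_i = corner f i,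
-- clockwise) is a clockwise empty black triangle of s, and s' is obtained
-- by the clockwise move changing f.
ClockwiseMove : ∀ {t v} (T : Trinity t v) → State T → State T → Fin t → Set
ClockwiseMove T s s' f =
  Black T f ×
  (∀ (i : Fin 3) (w : WhiteTri T) → proj₁ w ≡ proj₁ (glue T f i) →
     (match s w ≡ corner T f (next3 i)) × (match s' w ≡ corner T f i)) ×
  (∀ (w : WhiteTri T) → (∀ (i : Fin 3) → proj₁ w ≢ proj₁ (glue T f i)) →
     match s' w ≡ match s w)

data ClockwiseMoves {t v} (T : Trinity t v) : State T → State T → List (Fin t) → Set where
  done : ∀ {s} → ClockwiseMoves T s s []
  move : ∀ {s s₁ s₂ f ℓ} → ClockwiseMove T s s₁ f → ClockwiseMoves T s₁ s₂ ℓ →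
         ClockwiseMoves T s s₂ (f ∷ ℓ)

occurrences : ∀ {t} → Fin t → List (Fin t) → ℕ
occurrences f [] = 0
occurrences f (g ∷ ℓ) with f ≟ g
... | yes _ = suc (occurrences f ℓ)
... | no _ = occurrences f ℓ

-- Isomorphism of trinities (orientation and colour preserving); the
-- numbering of the corners of a triangle may be rotated by rot f.

record Iso {t v t' v'} (T : Trinity t v) (T' : Trinity t' v') : Set where
  field
    τ   : Fin t → Fin t'
    ν   : Fin v → Fin v'
    rot : Fin t → Fin 3
    τ-bij : Bijective _≡_ _≡_ τ
    ν-bij : Bijective _≡_ _≡_ ν
    corner-pres : ∀ f i → corner T' (τ f) (i ⊕ rot f) ≡ ν (corner T f i)
    glue-pres   : ∀ f i → glue T' (τ f) (i ⊕ rot f) ≡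
                    (τ (proj₁ (glue T f i)) , (proj₂ (glue T f i) ⊕ rot (proj₁ (glue T f i))))
    colour-pres : ∀ x → colour T' (ν x) ≡ colour T x

-- The trinity F on S² with three vertices and two triangles.
-- Triangle 0 has corners 0,1,2 (blue, green, red: black); triangle 1
-- has corners 0,2,1 (white).

F-corner : Fin 2 → Fin 3 → Fin 3
F-corner zero i = i
F-corner (suc zero) zero = zero
F-corner (suc zero) (suc zero) = suc (suc zero)
F-corner (suc zero) (suc (suc zero)) = suc zero

neg3 : Fin 3 → Fin 3
neg3 zero = zero
neg3 (suc zero) = suc (suc zero)
neg3 (suc (suc zero)) = suc zero

F-glue : Fin 2 → Fin 3 → Fin 2 × Fin 3
F-glue zero i = (suc zero , neg3 (next3 i))
F-glue (suc zero) j = (zero , neg3 (next3 j))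

F-colour : Fin 3 → Colour
F-colour zero = blue
F-colour (suc zero) = green
F-colour (suc (suc zero)) = red

F : Trinity 2 3
F = record
  { corner = F-corner
  ; glue = F-glue
  ; colour = F-colour
  ; glue-invol = invol
  ; glue-irrefl = irrefl
  ; glue-corners = gc
  ; corner-surj = surj
  ; vertex-link = link
  ; nonempty = zero
  ; connected = conn
  ; proper = prop
  }
  where
    invol : ∀ f i → uncurry F-glue (F-glue f i) ≡ (f , i)
    irrefl : ∀ f i → F-glue f i ≢ (f , i)
    gc : ∀ f i →
      (F-corner (proj₁ (F-glue f i)) (proj₂ (F-glue f i)) ≡ F-corner f (next3 i)) ×
      (F-corner (proj₁ (F-glue f i)) (next3 (proj₂ (F-glue f i))) ≡ F-corner f i)
    surj : ∀ (x : Fin 3) → ∃₂ λ f i → F-corner f i ≡ x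
    link : ∀ f i g j → F-corner f i ≡ F-corner g j →
           ∃ λ k → iter k (turnOf F-glue) (f , i) ≡ (g , j)
    conn : ∀ f g → Reach F-glue f g
    prop : ∀ f i → F-colour (F-corner f i) ≢ F-colour (F-corner f (next3 i))
    invol zero zero = refl
    invol zero (suc zero) = refl
    invol zero (suc (suc zero)) = refl
    invol (suc zero) zero = refl
    invol (suc zero) (suc zero) = refl
    invol (suc zero) (suc (suc zero)) = refl
    irrefl zero zero = λ ()
    irrefl zero (suc zero) = λ ()
    irrefl zero (suc (suc zero)) = λ ()
    irrefl (suc zero) zero = λ ()
    irrefl (suc zero) (suc zero) = λ ()
    irrefl (suc zero) (suc (suc zero)) = λ ()
    gc zero zero = refl , refl
    gc zero (suc zero) = refl , refl
    gc zero (suc (suc zero)) = refl , refl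
    gc (suc zero) zero = refl , refl
    gc (suc zero) (suc zero) = refl , refl
    gc (suc zero) (suc (suc zero)) = refl , refl
    prop zero zero = λ ()
    prop zero (suc zero) = λ ()
    prop zero (suc (suc zero)) = λ ()
    prop (suc zero) zero = λ ()
    prop (suc zero) (suc zero) = λ ()
    prop (suc zero) (suc (suc zero)) = λ ()
    surj zero = zero , zero , refl
    surj (suc zero) = zero , (suc zero) , refl
    surj (suc (suc zero)) = zero , (suc (suc zero)) , refl
    conn zero zero = here
    conn zero (suc zero) = step zero here
    conn (suc zero) zero = step zero here
    conn (suc zero) (suc zero) = here
    link zero zero zero zero _ = 0 , refl
    link zero zero zero (suc zero) ()
    link zero zero zero (suc (suc zero)) ()
    link zero zero (suc zero) zero _ = 1 , refl
    link zero zero (suc zero) (suc zero) ()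
    link zero zero (suc zero) (suc (suc zero)) ()
    link zero (suc zero) zero zero ()
    link zero (suc zero) zero (suc zero) _ = 0 , refl
    link zero (suc zero) zero (suc (suc zero)) ()
    link zero (suc zero) (suc zero) zero ()
    link zero (suc zero) (suc zero) (suc zero) ()
    link zero (suc zero) (suc zero) (suc (suc zero)) _ = 1 , refl
    link zero (suc (suc zero)) zero zero ()
    link zero (suc (suc zero)) zero (suc zero) ()
    link zero (suc (suc zero)) zero (suc (suc zero)) _ = 0 , refl
    link zero (suc (suc zero)) (suc zero) zero ()
    link zero (suc (suc zero)) (suc zero) (suc zero) _ = 1 , refl
    link zero (suc (suc zero)) (suc zero) (suc (suc zero)) ()
    link (suc zero) zero zero zero _ = 1 , refl
    link (suc zero) zero zero (suc zero) ()
    link (suc zero) zero zero (suc (suc zero)) ()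
    link (suc zero) zero (suc zero) zero _ = 0 , refl
    link (suc zero) zero (suc zero) (suc zero) ()
    link (suc zero) zero (suc zero) (suc (suc zero)) ()
    link (suc zero) (suc zero) zero zero ()
    link (suc zero) (suc zero) zero (suc zero) ()
    link (suc zero) (suc zero) zero (suc (suc zero)) _ = 1 , refl
    link (suc zero) (suc zero) (suc zero) zero ()
    link (suc zero) (suc zero) (suc zero) (suc zero) _ = 0 , refl
    link (suc zero) (suc zero) (suc zero) (suc (suc zero)) ()
    link (suc zero) (suc (suc zero)) zero zero ()
    link (suc zero) (suc (suc zero)) zero (suc zero) _ = 1 , refl
    link (suc zero) (suc (suc zero)) zero (suc (suc zero)) ()
    link (suc zero) (suc (suc zero)) (suc zero) zero ()
    link (suc zero) (suc (suc zero)) (suc zero) (suc zero) ()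
    link (suc zero) (suc (suc zero)) (suc zero) (suc (suc zero)) _ = 0 , refl

-- ConnectedSum T T' Δ T₀ o : T is (isomorphic to) the connected sum
-- T' # T₀ obtained by removing the interior of the black triangle Δ of T'
-- and gluing in T₀ minus the interior of its outer (white) triangle o,
-- matching colours on the boundary.  The data is an isomorphism from
-- the glued complex to T: the triangles of T are exactly the triangles
-- of T' other than Δ together with those of T₀ other than o; the
-- vertices of T are those of T' and T₀, where a vertex of o is
-- identified with the vertex of Δ of the same colour (and no other
-- identifications); corners (up to rotation), colours and gluings are
-- preserved, except that a side glued to a side of Δ in T' is now glued
-- to the side of T₀ that was glued to the corresponding (same-coloured)
-- side of o.

record ConnectedSum {t v t' v' t₀ v₀} (T : Trinity t v)
    (T' : Trinity t' v') (Δ : Fin t') (T₀ : Trinity t₀ v₀) (o : Fin t₀) : Set where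
  field
    τ'  : Fin t' → Fin t
    τ₀  : Fin t₀ → Fin t
    r'  : Fin t' → Fin 3
    r₀  : Fin t₀ → Fin 3
    ν'  : Fin v' → Fin v
    ν₀  : Fin v₀ → Fin v
    τ'-inj  : ∀ g h → g ≢ Δ → h ≢ Δ → τ' g ≡ τ' h → g ≡ h
    τ₀-inj  : ∀ g h → g ≢ o → h ≢ o → τ₀ g ≡ τ₀ h → g ≡ h
    τ-disj  : ∀ g h → g ≢ Δ → h ≢ o → τ' g ≢ τ₀ h
    τ-surj  : ∀ x → (∃ λ g → g ≢ Δ × τ' g ≡ x) ⊎ (∃ λ h → h ≢ o × τ₀ h ≡ x)
    ν'-inj  : Injective _≡_ _≡_ ν'
    ν₀-inj  : Injective _≡_ _≡_ ν₀
    ν-bdry  : ∀ i k → colour T₀ (corner T₀ o k) ≡ colour T' (corner T' Δ i) →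
              ν₀ (corner T₀ o k) ≡ ν' (corner T' Δ i)
    ν-overlap : ∀ x y → ν' x ≡ ν₀ y →
              ∃₂ λ i k → (x ≡ corner T' Δ i) × (y ≡ corner T₀ o k)
    ν-surj  : ∀ x → (∃ λ y → ν' y ≡ x) ⊎ (∃ λ y → ν₀ y ≡ x)
    colour' : ∀ x → colour T (ν' x) ≡ colour T' x
    colour₀ : ∀ x → colour T (ν₀ x) ≡ colour T₀ x
    corner' : ∀ g i → g ≢ Δ → corner T (τ' g) (i ⊕ r' g) ≡ ν' (corner T' g i)
    corner₀ : ∀ g i → g ≢ o → corner T (τ₀ g) (i ⊕ r₀ g) ≡ ν₀ (corner T₀ g i)
    glue'   : ∀ g i → g ≢ Δ → proj₁ (glue T' g i) ≢ Δ →
              glue T (τ' g) (i ⊕ r' g) ≡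
                (τ' (proj₁ (glue T' g i)) , (proj₂ (glue T' g i) ⊕ r' (proj₁ (glue T' g i))))
    glue₀   : ∀ g i → g ≢ o → proj₁ (glue T₀ g i) ≢ o →
              glue T (τ₀ g) (i ⊕ r₀ g) ≡
                (τ₀ (proj₁ (glue T₀ g i)) , (proj₂ (glue T₀ g i) ⊕ r₀ (proj₁ (glue T₀ g i))))
    -- new gluings across the boundary: side i of g was glued to side j of
    -- Δ (from corner j to corner j+1 of Δ); side k of o (from corner k
    -- to corner k+1 of o) with corner k of o coloured like corner j+1 of
    -- Δ is the matching side of o.
    glue'₀  : ∀ g i → g ≢ Δ → proj₁ (glue T' g i) ≡ Δ → ∀ k →
              colour T₀ (corner T₀ o k) ≡ colour T' (corner T' Δ (next3 (proj₂ (glue T' g i)))) →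
              glue T (τ' g) (i ⊕ r' g) ≡
                (τ₀ (proj₁ (glue T₀ o k)) , (proj₂ (glue T₀ o k) ⊕ r₀ (proj₁ (glue T₀ o k))))

Irreducible : ∀ {t v} → Trinity t v → Set
Irreducible T =
  ¬ Iso T F ×
  (∀ {t' v' t₀ v₀} (T' : Trinity t' v') (Δ : Fin t') (T₀ : Trinity t₀ v₀) (o : Fin t₀) →
     Black T' Δ → Spherical T₀ → White T₀ o → ConnectedSum T T' Δ T₀ o →
     Iso T' F ⊎ Iso T₀ F)

module Submission where

-- Fix a white triangle W and look at the corner of W
-- to which a state matches it.  A clockwise move changing a black
-- triangle f leaves this corner alone unless f is the neighbour of W
-- across the side starting at the matched corner p, in which case the
-- matched corner advances from p to p+1 (mod 3).  Hence during any
-- sequence of clockwise moves the matched corner of W winds around W,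
-- and the three black neighbours of W are changed in cyclic order; if
-- the sequence returns to its initial state, every neighbour of W has
-- been changed equally often (the number of full turns).  Since the
-- dual graph is connected and black and white triangles alternate
-- across every side, the counts of all black triangles agree.

open import Defs
open import Data.Nat using (ℕ; suc; _+_)
open import Data.Nat.Properties using (+-comm; +-assoc; +-cancelʳ-≡)
open import Data.Fin using (Fin; zero; suc; _≟_; _≤?_)
open import Data.Fin.Properties using (any?)
open import Data.List using (List; []; _∷_)
open import Data.Bool using (true; false; not; if_then_else_)
open import Data.Product using (_×_; _,_; proj₁; proj₂; uncurry)
open import Data.Empty using (⊥-elim)
open import Relation.Nullary using (Dec; yes; no; does)
open import Relation.Nullary.Decidable using (dec-true; dec-false)
open import Relation.Binary.PropositionalEquality
  using (_≡_; _≢_; refl; sym; trans; cong; cong₂; subst; module ≡-Reasoning)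

data Rainbow : Colour → Colour → Colour → Set where
  bgr : Rainbow blue green red
  grb : Rainbow green red blue
  rbg : Rainbow red blue green
  rgb : Rainbow red green blue
  gbr : Rainbow green blue red
  brg : Rainbow blue red green

rainbow : ∀ {a b c} → a ≢ b → b ≢ c → c ≢ a → Rainbow a b c
rainbow {red} {red} a≢b _ _ = ⊥-elim (a≢b refl)
rainbow {green} {green} a≢b _ _ = ⊥-elim (a≢b refl)
rainbow {blue} {blue} a≢b _ _ = ⊥-elim (a≢b refl)
rainbow {red} {green} {red} _ _ c≢a = ⊥-elim (c≢a refl)
rainbow {red} {green} {green} _ b≢c _ = ⊥-elim (b≢c refl)
rainbow {red} {green} {blue} _ _ _ = rgb
rainbow {red} {blue} {red} _ _ c≢a = ⊥-elim (c≢a refl)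
rainbow {red} {blue} {green} _ _ _ = rbg
rainbow {red} {blue} {blue} _ b≢c _ = ⊥-elim (b≢c refl)
rainbow {green} {red} {red} _ b≢c _ = ⊥-elim (b≢c refl)
rainbow {green} {red} {green} _ _ c≢a = ⊥-elim (c≢a refl)
rainbow {green} {red} {blue} _ _ _ = grb
rainbow {green} {blue} {red} _ _ _ = gbr
rainbow {green} {blue} {green} _ _ c≢a = ⊥-elim (c≢a refl)
rainbow {green} {blue} {blue} _ b≢c _ = ⊥-elim (b≢c refl)
rainbow {blue} {red} {red} _ b≢c _ = ⊥-elim (b≢c refl)
rainbow {blue} {red} {green} _ _ _ = brg
rainbow {blue} {red} {blue} _ _ c≢a = ⊥-elim (c≢a refl)
rainbow {blue} {green} {red} _ _ _ = bgr
rainbow {blue} {green} {green} _ b≢c _ = ⊥-elim (b≢c refl)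
rainbow {blue} {green} {blue} _ _ c≢a = ⊥-elim (c≢a refl)

black-rotate : ∀ {a b c} → Rainbow a b c → blackCols a b c ≡ blackCols b c a
black-rotate bgr = refl
black-rotate grb = refl
black-rotate rbg = refl
black-rotate rgb = refl
black-rotate gbr = refl
black-rotate brg = refl

black-flip : ∀ {a b c c′} → Rainbow a b c → Rainbow b a c′ →
             blackCols b a c′ ≡ not (blackCols a b c)
black-flip bgr gbr = refl
black-flip grb rgb = refl
black-flip rbg brg = refl
black-flip rgb grb = refl
black-flip gbr bgr = refl
black-flip brg rbg = refl

occurrences-hit : ∀ {t} {f g : Fin t} (ℓ : List (Fin t)) → f ≡ g →
                  occurrences f (g ∷ ℓ) ≡ suc (occurrences f ℓ)
occurrences-hit {f = f} {g} ℓ f≡g with f ≟ g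
... | yes _ = refl
... | no f≢g = ⊥-elim (f≢g f≡g)

occurrences-miss : ∀ {t} {f g : Fin t} (ℓ : List (Fin t)) → f ≢ g →
                   occurrences f (g ∷ ℓ) ≡ occurrences f ℓ
occurrences-miss {f = f} {g} ℓ f≢g with f ≟ g
... | yes f≡g = ⊥-elim (f≢g f≡g)
... | no _ = refl

indicator : ∀ {n} → Fin n → Fin n → ℕ
indicator k p = if does (k ≟ p) then 1 else 0

indicator-self : ∀ {n} (p : Fin n) → indicator p p ≡ 1
indicator-self p rewrite dec-true (p ≟ p) refl = refl

indicator-other : ∀ {n} {k p : Fin n} → k ≢ p → indicator k p ≡ 0
indicator-other {k = k} {p} k≢p rewrite dec-false (k ≟ p) k≢p = refl

-- The potential [p ≤ k] of side k when the matched corner is p, and the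
-- number [p + 1 = 0] of completed turns when the matched corner advances
-- from p.
atOrAfter : Fin 3 → Fin 3 → ℕ
atOrAfter p k = if does (p ≤? k) then 1 else 0

wraps : Fin 3 → ℕ
wraps p = indicator (next3 p) zero

-- Advancing the matched corner from p (one extra move across side p)
-- changes the potential of every side only by a completed turn.
advance : ∀ p k → indicator k p + atOrAfter (next3 p) k ≡ wraps p + atOrAfter p k
advance zero zero = refl
advance zero (suc zero) = refl
advance zero (suc (suc zero)) = refl
advance (suc zero) zero = refl
advance (suc zero) (suc zero) = refl
advance (suc zero) (suc (suc zero)) = refl
advance (suc (suc zero)) zero = refl
advance (suc (suc zero)) (suc zero) = refl
advance (suc (suc zero)) (suc (suc zero)) = refl

advance-bookkeeping : ∀ {o′ o x K x′ i w y} → o′ ≡ i + o → o + x ≡ K + x′ → i + x′ ≡ w + y →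
                      o′ + x ≡ (w + K) + y
advance-bookkeeping {o′} {o} {x} {K} {x′} {i} {w} {y} count rest advanced = begin
  o′ + x          ≡⟨ cong (_+ x) count ⟩
  (i + o) + x     ≡⟨ +-assoc i o x ⟩
  i + (o + x)     ≡⟨ cong (i +_) rest ⟩
  i + (K + x′)    ≡⟨ sym (+-assoc i K x′) ⟩
  (i + K) + x′    ≡⟨ cong (_+ x′) (+-comm i K) ⟩
  (K + i) + x′    ≡⟨ +-assoc K i x′ ⟩
  K + (i + x′)    ≡⟨ cong (K +_) advanced ⟩
  K + (w + y)     ≡⟨ sym (+-assoc K w y) ⟩
  (K + w) + y     ≡⟨ cong (_+ y) (+-comm K w) ⟩
  (w + K) + y     ∎
  where open ≡-Reasoning

module _ {t : ℕ} (nb : Fin 3 → Fin t) where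

  data CornerStep (f : Fin t) (p p′ : Fin 3) : Set where
    stays    : p′ ≡ p → (∀ k → nb k ≢ f) → CornerStep f p p′
    advances : p′ ≡ next3 p → (∀ k → nb k ≡ f → k ≡ p) → nb p ≡ f → CornerStep f p p′

  -- The winding invariant for a sequence ℓ of changed triangles during
  -- which the matched corner goes from p to p′: up to a common number of
  -- turns, the sides in the cyclic arc from p to p′ have been crossed
  -- once more than the others.
  record Balanced (ℓ : List (Fin t)) (p p′ : Fin 3) : Set where
    constructor balanced
    field
      turns   : ℕ
      winding : ∀ k → occurrences (nb k) ℓ + atOrAfter p′ k ≡ turns + atOrAfter p k

  balanced-[] : ∀ p → Balanced [] p p
  balanced-[] p = balanced 0 λ k → refl

  occurrences-advance : ∀ {f p} (ℓ : List (Fin t)) → (∀ k → nb k ≡ f → k ≡ p) → nb p ≡ f →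
                        ∀ k → occurrences (nb k) (f ∷ ℓ) ≡ indicator k p + occurrences (nb k) ℓ
  occurrences-advance {f} {p} ℓ only hit k = counted (nb k ≟ f)
    where
      counted : Dec (nb k ≡ f) → occurrences (nb k) (f ∷ ℓ) ≡ indicator k p + occurrences (nb k) ℓ
      counted (yes nbk≡f) =
        trans (occurrences-hit ℓ nbk≡f)
              (cong (_+ occurrences (nb k) ℓ)
                    (sym (trans (cong (λ x → indicator x p) (only k nbk≡f)) (indicator-self p))))
      counted (no nbk≢f) =
        trans (occurrences-miss ℓ nbk≢f)
              (cong (_+ occurrences (nb k) ℓ)
                    (sym (indicator-other (λ k≡p → nbk≢f (trans (cong nb k≡p) hit)))))

  balanced-∷ : ∀ {f p p₁ p′ ℓ} → CornerStep f p p₁ → Balanced ℓ p₁ p′ → Balanced (f ∷ ℓ) p p′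
  balanced-∷ {p′ = p′} {ℓ} (stays refl untouched) (balanced turns rest) =
    balanced turns λ k → trans (cong (_+ atOrAfter p′ k) (occurrences-miss ℓ (untouched k))) (rest k)
  balanced-∷ {p = p} {ℓ = ℓ} (advances refl only hit) (balanced turns rest) =
    balanced (wraps p + turns) λ k →
      advance-bookkeeping {w = wraps p} {y = atOrAfter p k} (occurrences-advance ℓ only hit k) (rest k) (advance p k)

  balanced-loop : ∀ {ℓ p} → Balanced ℓ p p → ∀ k k′ → occurrences (nb k) ℓ ≡ occurrences (nb k′) ℓ
  balanced-loop {p = p} (balanced turns loop) k k′ =
    trans (+-cancelʳ-≡ (atOrAfter p k) _ _ (loop k))
          (sym (+-cancelʳ-≡ (atOrAfter p k′) _ _ (loop k′)))

module _ {t v : ℕ} (T : Trinity t v) where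

  colourAt : Fin t → Fin 3 → Colour
  colourAt f i = colour T (corner T f i)

  neighbour : Fin t → Fin 3 → Fin t
  neighbour f i = proj₁ (glue T f i)

  corner-rainbow : ∀ f i → Rainbow (colourAt f i) (colourAt f (next3 i)) (colourAt f (next3 (next3 i)))
  corner-rainbow f zero = rainbow (proper T f zero) (proper T f (suc zero)) (proper T f (suc (suc zero)))
  corner-rainbow f (suc zero) = rainbow (proper T f (suc zero)) (proper T f (suc (suc zero))) (proper T f zero)
  corner-rainbow f (suc (suc zero)) = rainbow (proper T f (suc (suc zero))) (proper T f zero) (proper T f (suc zero))

  isBlack-at : ∀ f i → isBlack T f ≡ blackCols (colourAt f i) (colourAt f (next3 i)) (colourAt f (next3 (next3 i)))
  isBlack-at f zero = refl
  isBlack-at f (suc zero) = black-rotate (corner-rainbow f zero)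
  isBlack-at f (suc (suc zero)) =
    trans (black-rotate (corner-rainbow f zero)) (black-rotate (corner-rainbow f (suc zero)))

  corner-injective : ∀ f a b → corner T f a ≡ corner T f b → a ≡ b
  corner-injective f zero zero _ = refl
  corner-injective f zero (suc zero) e = ⊥-elim (proper T f zero (cong (colour T) e))
  corner-injective f zero (suc (suc zero)) e = ⊥-elim (proper T f (suc (suc zero)) (cong (colour T) (sym e)))
  corner-injective f (suc zero) zero e = ⊥-elim (proper T f zero (cong (colour T) (sym e)))
  corner-injective f (suc zero) (suc zero) _ = refl
  corner-injective f (suc zero) (suc (suc zero)) e = ⊥-elim (proper T f (suc zero) (cong (colour T) e))
  corner-injective f (suc (suc zero)) zero e = ⊥-elim (proper T f (suc (suc zero)) (cong (colour T) e))
  corner-injective f (suc (suc zero)) (suc zero) e = ⊥-elim (proper T f (suc zero) (cong (colour T) (sym e)))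
  corner-injective f (suc (suc zero)) (suc (suc zero)) _ = refl

  glue-sym : ∀ {f i g j} → glue T f i ≡ (g , j) → glue T g j ≡ (f , i)
  glue-sym {f} {i} e = subst (λ side → uncurry (glue T) side ≡ (f , i)) e (glue-invol T f i)

  shared-side : ∀ {f i g j} → glue T f i ≡ (g , j) →
                (corner T g j ≡ corner T f (next3 i)) × (corner T g (next3 j) ≡ corner T f i)
  shared-side {f} {i} e =
    subst (λ side → (corner T (proj₁ side) (proj₂ side) ≡ corner T f (next3 i)) ×
                    (corner T (proj₁ side) (next3 (proj₂ side)) ≡ corner T f i))
          e (glue-corners T f i)

  neighbour-back : ∀ {W k f} → neighbour W k ≡ f → glue T f (proj₂ (glue T W k)) ≡ (W , k)
  neighbour-back nb≡f = glue-sym (cong (_, _) nb≡f)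

  opposite-colours : ∀ f i → isBlack T (neighbour f i) ≡ not (isBlack T f)
  opposite-colours f i = begin
    isBlack T g                                   ≡⟨ isBlack-at g j ⟩
    blackCols (colourAt g j) (colourAt g (next3 j)) c′
                                                  ≡⟨ cong₂ (λ a b → blackCols a b c′) same₁ same₂ ⟩
    blackCols (colourAt f (next3 i)) (colourAt f i) c′
                                                  ≡⟨ black-flip (corner-rainbow f i) flipped ⟩
    not (blackCols (colourAt f i) (colourAt f (next3 i)) (colourAt f (next3 (next3 i))))
                                                  ≡⟨ cong not (sym (isBlack-at f i)) ⟩
    not (isBlack T f)                             ∎
    where
      open ≡-Reasoning
      g = neighbour f i
      j = proj₂ (glue T f i)
      c′ = colourAt g (next3 (next3 j))
      same₁ : colourAt g j ≡ colourAt f (next3 i)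
      same₁ = cong (colour T) (proj₁ (shared-side {g = g} {j} refl))
      same₂ : colourAt g (next3 j) ≡ colourAt f i
      same₂ = cong (colour T) (proj₂ (shared-side {g = g} {j} refl))
      flipped : Rainbow (colourAt f (next3 i)) (colourAt f i) c′
      flipped = subst (λ a → Rainbow a (colourAt f i) c′) same₁
                  (subst (λ b → Rainbow (colourAt g j) b c′) same₂ (corner-rainbow g j))

  -- A function constant on the three neighbours of every white triangle
  -- is constant on black triangles, because the dual graph is connected
  -- and colours alternate along it.
  constant-on-black : (c : Fin t → ℕ) →
    (∀ (w : WhiteTri T) k k′ → c (neighbour (proj₁ w) k) ≡ c (neighbour (proj₁ w) k′)) →
    ∀ f g → Black T f → Black T g → c f ≡ c g
  constant-on-black c white-constant f g bf bg = proj₁ (along (connected T f g)) bf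
    where
      along : ∀ {h} → Reach (glue T) h g →
              (Black T h → c h ≡ c g) × (White T h → ∀ k → c (neighbour h k) ≡ c g)
      along here = (λ _ → refl) , (λ wg → ⊥-elim (black-not-white (trans (sym bg) wg)))
        where
          black-not-white : true ≢ false
          black-not-white ()
      along {h} (step i rest) with along rest
      ... | fromBlack , fromWhite =
        (λ bh → trans (cong c (sym (cong proj₁ (glue-invol T h i))))
                      (fromWhite (trans (opposite-colours h i) (cong not bh)) (proj₂ (glue T h i)))) ,
        (λ wh k → trans (white-constant (h , wh) k i) (fromBlack (trans (opposite-colours h i) (cong not wh))))

  matched : State T → WhiteTri T → Fin 3
  matched s w = proj₁ (own s w)

  matched-unique : ∀ s w k → corner T (proj₁ w) k ≡ match s w → k ≡ matched s w
  matched-unique s w k e = corner-injective (proj₁ w) k (matched s w) (trans e (sym (proj₂ (own s w))))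

  clockwise-step : ∀ {s s′ f} → ClockwiseMove T s s′ f → ∀ (w : WhiteTri T) →
                   CornerStep (neighbour (proj₁ w)) f (matched s w) (matched s′ w)
  clockwise-step {s} {s′} {f} (_ , adjacent , elsewhere) w with any? (λ i → proj₁ w ≟ neighbour f i)
  ... | no notAdjacent = stays kept untouched
    where
      kept : matched s′ w ≡ matched s w
      kept = matched-unique s w (matched s′ w)
               (trans (proj₂ (own s′ w)) (elsewhere w λ i e → notAdjacent (i , e)))
      untouched : ∀ k → neighbour (proj₁ w) k ≢ f
      untouched k nb≡f = notAdjacent (_ , cong proj₁ (sym (neighbour-back nb≡f)))
  ... | yes (i , W≡fi) = advances moved only hit
    where
      W = proj₁ w
      j = proj₂ (glue T f i)
      side : glue T f i ≡ (W , j)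
      side = cong (_, j) (sym W≡fi)
      before : j ≡ matched s w
      before = matched-unique s w j
                 (trans (proj₁ (shared-side side)) (sym (proj₁ (adjacent i w W≡fi))))
      after : next3 j ≡ matched s′ w
      after = matched-unique s′ w (next3 j)
                (trans (proj₂ (shared-side side)) (sym (proj₂ (adjacent i w W≡fi))))
      moved : matched s′ w ≡ next3 (matched s w)
      moved = trans (sym after) (cong next3 before)
      hit : neighbour W (matched s w) ≡ f
      hit = subst (λ k → neighbour W k ≡ f) before (cong proj₁ (glue-sym side))
      only : ∀ k → neighbour W k ≡ f → k ≡ matched s w
      only k nb≡f = matched-unique s w k
        (trans (proj₁ (shared-side back))
               (sym (proj₁ (adjacent _ w (cong proj₁ (sym back))))))
        where back = neighbour-back nb≡f

  moves-balanced : ∀ {s s′ ℓ} → ClockwiseMoves T s s′ ℓ → ∀ (w : WhiteTri T) →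
                   Balanced (neighbour (proj₁ w)) ℓ (matched s w) (matched s′ w)
  moves-balanced {s} done w = balanced-[] (neighbour (proj₁ w)) (matched s w)
  moves-balanced {s} (move {s₁ = s₁} m ms) w =
    balanced-∷ (neighbour (proj₁ w)) (clockwise-step {s} {s₁} m w) (moves-balanced ms w)

  white-neighbours-equal : ∀ {s₀ s₁ ℓ} → ClockwiseMoves T s₀ s₁ ℓ → SameState s₀ s₁ →
    ∀ (w : WhiteTri T) k k′ →
    occurrences (neighbour (proj₁ w) k) ℓ ≡ occurrences (neighbour (proj₁ w) k′) ℓ
  white-neighbours-equal {s₀} {s₁} {ℓ} ms same w =
    balanced-loop (neighbour (proj₁ w)) (subst (Balanced (neighbour (proj₁ w)) ℓ (matched s₀ w)) returns (moves-balanced ms w))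
    where
      returns : matched s₁ w ≡ matched s₀ w
      returns = matched-unique s₀ w (matched s₁ w) (trans (proj₂ (own s₁ w)) (sym (same w)))

proposition5p5 : ∀ {t v} (T : Trinity t v) → Toric T → Irreducible T →
    ∀ {s₀ s₁ : State T} {ℓ : List (Fin t)} → ClockwiseMoves T s₀ s₁ ℓ → SameState s₀ s₁ →
    ∀ (f g : Fin t) → Black T f → Black T g → occurrences f ℓ ≡ occurrences g ℓ
proposition5p5 T _ _ {ℓ = ℓ} moves same =
  constant-on-black T (λ h → occurrences h ℓ) (white-neighbours-equal T moves same)
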